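{- For integers $k\ge 4$ and $n\ge 2$, let $G_{k,n}$ be the graph obtained from the complete graph $K_k$ by replacing every edge with $n$ internally disjoint paths of length $2$ (i.e., for each pair $x_i,x_j$ of original vertices, $n$ new vertices each adjacent exactly to $x_i$ and $x_j$), and then adding one further vertex adjacent to all other vertices. Then $$\mathrm{sg}(G_{k,n}) = \binom{k}{2} (n-1) + k \quad \text{and} \quad \mathrm{sg}(G_{k,n} \,\square\, K_n) \leq k n + 1.$$
   Context: $\square$ denotes the Cartesian product (vertex set $V(G)\times V(H)$, $(g,h)\sim(g',h')$ iff either $g=g'$ and $hh'\in E(H)$, or $h=h'$ and $gg'\in E(G)$). For a connected graph $G$ and $S\subseteq V(G)$, $S$ is a strong geodetic set if one can fix, for each unordered pair of distinct $x,y\in S$, a single shortest $x,y$-path so that the union of the vertex sets of the chosen paths is $V(G)$; $\mathrm{sg}(G)$ is the minimum size of a strong geodetic set. -}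

module Defs where

open import Data.Nat using (ℕ; zero; suc; _≤_)
open import Data.Fin using (Fin) renaming (_<_ to _<ᶠ_)
open import Data.List using (List; []; _∷_; length; lookup)
open import Data.List.Membership.Propositional using (_∈_)
open import Data.List.Relation.Unary.Unique.Propositional using (Unique)
open import Data.Product using (Σ; ∃; _×_; _,_)
open import Data.Sum using (_⊎_)
open import Data.Empty using (⊥)
open import Data.Unit using (⊤)
open import Relation.Binary.PropositionalEquality using (_≡_; _≢_)

record Graph : Set₁ where
  field
    V   : Set
    Adj : V → V → Set
open Graph public

data Walk (G : Graph) : V G → V G → ℕ → Set where
  here : ∀ {x} → Walk G x x 0
  step : ∀ {x z y m} → Adj G x z → Walk G z y m → Walk G x y (suc m)

walkVertices : ∀ {G x y m} → Walk G x y m → List (V G)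
walkVertices (here {x}) = x ∷ []
walkVertices (step {x = x} _ w) = x ∷ walkVertices w

record ShortestPath (G : Graph) (x y : V G) : Set where
  field
    len     : ℕ
    walk    : Walk G x y len
    minimal : ∀ m → Walk G x y m → len ≤ m
open ShortestPath public

-- S (a list of distinct vertices) is a strong geodetic set: one shortest path is
-- fixed for every unordered pair of distinct elements of S (pairs of positions i < j),
-- and the union of their vertex sets is all of V(G).
record StrongGeodetic (G : Graph) (S : List (V G)) : Set where
  field
    distinct : Unique S
    path     : (i j : Fin (length S)) → i <ᶠ j → ShortestPath G (lookup S i) (lookup S j)
    covers   : ∀ v → Σ (Fin (length S)) λ i → Σ (Fin (length S)) λ j → Σ (i <ᶠ j) λ i<j →
                 v ∈ walkVertices (walk (path i j i<j))

SgEq : Graph → ℕ → Set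
SgEq G c = (Σ (List (V G)) λ S → StrongGeodetic G S × length S ≡ c)
         × (∀ S → StrongGeodetic G S → c ≤ length S)

_□_ : Graph → Graph → Graph
G □ H = record
  { V   = V G × V H
  ; Adj = λ { (g , h) (g' , h') → (g ≡ g' × Adj H h h') ⊎ (h ≡ h' × Adj G g g') } }

K : ℕ → Graph
K n = record { V = Fin n ; Adj = λ i j → i ≢ j }

data GV (k n : ℕ) : Set where
  orig : Fin k → GV k n
  sub  : (i j : Fin k) → i <ᶠ j → Fin n → GV k n
  apex : GV k n

GAdj : ∀ {k n} → GV k n → GV k n → Set
GAdj (orig a)      (orig b)      = ⊥
GAdj (orig a)      (sub i j _ _) = a ≡ i ⊎ a ≡ j
GAdj (orig a)      apex          = ⊤
GAdj (sub i j _ _) (orig a)      = a ≡ i ⊎ a ≡ j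
GAdj (sub _ _ _ _) (sub _ _ _ _) = ⊥
GAdj (sub _ _ _ _) apex          = ⊤
GAdj apex          (orig _)      = ⊤
GAdj apex          (sub _ _ _ _) = ⊤
GAdj apex          apex          = ⊥

Gkn : ℕ → ℕ → Graph
Gkn k n = record { V = GV k n ; Adj = GAdj }

-- G_{k,n} has diameter 2, and a subdivision vertex s of the pair {i, j} can lie
-- inside a geodesic only as the middle of x_i - s - x_j.  Lower bound: in a strong
-- geodetic set S, (A) at most one subdivision vertex of each pair is missing, and
-- (B) if x_a is missing then all subdivision vertices next to x_a are present.
-- An explicit injection from (k C 2)(n-1) + k slots into S follows.  Upper bound:
-- the original vertices with all but the last subdivision vertex of each pair form
-- a strong geodetic set.

module Submission where

open import Defs
open import Data.Nat using (ℕ; _+_; _*_; _∸_; _≤_)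
open import Data.Nat.Combinatorics using (_C_)
open import Data.List using (List; length)
open import Data.Product using (Σ; _×_)

open import Data.Nat using (zero; suc; z≤n; s≤s)
import Data.Nat.Properties as ℕ
open import Data.Nat.Combinatorics using (nC1≡n; nCk+nC[k+1]≡[n+1]C[k+1])
open import Data.Fin using (Fin; toℕ; inject₁; fromℕ; punchIn) renaming (zero to fz; suc to fs; _<_ to _<ᶠ_)
open import Data.Fin.Properties as Fin using (<-cmp; +↔⊎; *↔×)
open import Data.Fin.Relation.Unary.Top using (View; view; ‵fromℕ; ‵inj₁)
open import Data.List using ([]; _∷_; lookup; tabulate)
open import Data.List.Properties using (length-tabulate)
open import Data.List.Relation.Unary.Any using (here; there; index)
open import Data.List.Relation.Unary.Any.Properties using (lookup-index)
import Data.List.Relation.Unary.All as All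
open import Data.List.Relation.Unary.AllPairs using (_∷_)
open import Data.List.Membership.Propositional using (_∈_; _∉_)
open import Data.List.Membership.Propositional.Properties using (∈-lookup; ∈-tabulate⁺)
open import Data.List.Membership.Setoid.Properties using (index-injective)
open import Data.List.Relation.Unary.Unique.Propositional using (Unique)
open import Data.List.Relation.Unary.Unique.Propositional.Properties using (tabulate⁺)
open import Data.Product using (_,_; proj₁; proj₂; ∃)
open import Data.Sum using (_⊎_; inj₁; inj₂)
open import Data.Sum.Function.Propositional using (_⊎-↔_)
open import Data.Product.Function.NonDependent.Propositional using (_×-↔_)
open import Data.Empty using (⊥; ⊥-elim)
open import Data.Unit using (tt)
open import Function using (_∘_; _↔_; mk↔ₛ′; Inverse)
open import Function.Properties.Inverse using (↔-refl; ↔-sym; ↔-trans)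
open import Relation.Binary using (Tri; tri<; tri≈; tri>; DecidableEquality)
open import Relation.Nullary using (¬_; Dec; yes; no)
open import Relation.Nullary.Decidable using (_⊎-dec_; ¬?; decidable-stable)
open import Relation.Binary.PropositionalEquality using (_≡_; _≢_; refl; sym; trans; cong; subst; setoid)

module _ {G : Graph} where

  Verts : ∀ {a b} → ShortestPath G a b → List (V G)
  Verts p = walkVertices (walk p)

  _++ᵂ_ : ∀ {x y z m m'} → Walk G x y m → Walk G y z m' → Walk G x z (m + m')
  here     ++ᵂ w' = w'
  step a w ++ᵂ w' = step a (w ++ᵂ w')

  start∈ : ∀ {x y m} (w : Walk G x y m) → x ∈ walkVertices w
  start∈ here       = here refl
  start∈ (step a w) = here refl

  end∈ : ∀ {x y m} (w : Walk G x y m) → y ∈ walkVertices w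
  end∈ here       = here refl
  end∈ (step a w) = there (end∈ w)

  ∈-++ᵂˡ : ∀ {x y z m m' v} (w : Walk G x y m) (w' : Walk G y z m') →
           v ∈ walkVertices w → v ∈ walkVertices (w ++ᵂ w')
  ∈-++ᵂˡ here       w' (here refl) = start∈ w'
  ∈-++ᵂˡ (step a w) w' (here e)    = here e
  ∈-++ᵂˡ (step a w) w' (there p)   = there (∈-++ᵂˡ w w' p)

  ∈-++ᵂʳ : ∀ {x y z m m' v} (w : Walk G x y m) (w' : Walk G y z m') →
           v ∈ walkVertices w' → v ∈ walkVertices (w ++ᵂ w')
  ∈-++ᵂʳ here       w' p = p
  ∈-++ᵂʳ (step a w) w' p = there (∈-++ᵂʳ w w' p)

  walk₀⇒≡ : ∀ {x y} → Walk G x y 0 → x ≡ y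
  walk₀⇒≡ here = refl

  walk₁⇒Adj : ∀ {x y} → Walk G x y 1 → Adj G x y
  walk₁⇒Adj (step a here) = a

  trivialPath : ∀ x → ShortestPath G x x
  trivialPath x = record { len = 0 ; walk = here ; minimal = λ _ _ → z≤n }

  edgePath : ∀ {x y} → x ≢ y → Adj G x y → ShortestPath G x y
  edgePath x≢y a = record { len = 1 ; walk = step a here ; minimal = minimal₁ }
    where
    minimal₁ : ∀ m → Walk G _ _ m → 1 ≤ m
    minimal₁ zero    w = ⊥-elim (x≢y (walk₀⇒≡ w))
    minimal₁ (suc m) w = s≤s z≤n

  twoEdgePath : ∀ {x y} z → x ≢ y → ¬ Adj G x y → Adj G x z → Adj G z y → ShortestPath G x y
  twoEdgePath z x≢y ¬xy a b = record { len = 2 ; walk = step a (step b here) ; minimal = minimal₂ }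
    where
    minimal₂ : ∀ m → Walk G _ _ m → 2 ≤ m
    minimal₂ zero          w = ⊥-elim (x≢y (walk₀⇒≡ w))
    minimal₂ (suc zero)    w = ⊥-elim (¬xy (walk₁⇒Adj w))
    minimal₂ (suc (suc m)) w = s≤s (s≤s z≤n)

-- Shortest paths in a Cartesian product: a walk in G □ H projects to walks in
-- G and in H whose lengths add up, so a G-geodesic followed by an H-geodesic
-- (in either order) is a geodesic of G □ H.

module _ {G H : Graph} where

  liftG : ∀ {g g' m} h → Walk G g g' m → Walk (G □ H) (g , h) (g' , h) m
  liftG h here       = here
  liftG h (step a w) = step (inj₂ (refl , a)) (liftG h w)

  liftH : ∀ {h h' m} g → Walk H h h' m → Walk (G □ H) (g , h) (g , h') m
  liftH g here       = here
  liftH g (step a w) = step (inj₁ (refl , a)) (liftH g w)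

  ∈-liftG : ∀ {g g' m v} h (w : Walk G g g' m) → v ∈ walkVertices w → (v , h) ∈ walkVertices (liftG h w)
  ∈-liftG h here       (here refl) = here refl
  ∈-liftG h (step a w) (here refl) = here refl
  ∈-liftG h (step a w) (there p)   = there (∈-liftG h w p)

  ∈-liftH : ∀ {h h' m v} g (w : Walk H h h' m) → v ∈ walkVertices w → (g , v) ∈ walkVertices (liftH g w)
  ∈-liftH g here       (here refl) = here refl
  ∈-liftH g (step a w) (here refl) = here refl
  ∈-liftH g (step a w) (there p)   = there (∈-liftH g w p)

  ProjectedWalks : V (G □ H) → V (G □ H) → ℕ → Set
  ProjectedWalks (g , h) (g' , h') m =
    Σ ℕ λ m₁ → Σ ℕ λ m₂ → Walk G g g' m₁ × Walk H h h' m₂ × m ≡ m₁ + m₂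

  project : ∀ {x y m} → Walk (G □ H) x y m → ProjectedWalks x y m
  project here = 0 , 0 , here , here , refl
  project (step (inj₁ (refl , a)) w) with project w
  ... | m₁ , m₂ , wG , wH , refl = m₁ , suc m₂ , wG , step a wH , sym (ℕ.+-suc m₁ m₂)
  project (step (inj₂ (refl , a)) w) with project w
  ... | m₁ , m₂ , wG , wH , refl = suc m₁ , m₂ , step a wG , wH , refl

  productLowerBound : ∀ {g g' h h'} (pG : ShortestPath G g g') (pH : ShortestPath H h h') →
                      ∀ m → Walk (G □ H) (g , h) (g' , h') m → len pG + len pH ≤ m
  productLowerBound pG pH m w with project w
  ... | m₁ , m₂ , wG , wH , refl = ℕ.+-mono-≤ (minimal pG m₁ wG) (minimal pH m₂ wH)

  geodesicGH : ∀ {g g' h h'} → ShortestPath G g g' → ShortestPath H h h' → ShortestPath (G □ H) (g , h) (g' , h')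
  geodesicGH {g} {g'} {h} {h'} pG pH = record
    { len     = len pG + len pH
    ; walk    = liftG h (walk pG) ++ᵂ liftH g' (walk pH)
    ; minimal = productLowerBound pG pH }

  geodesicHG : ∀ {g g' h h'} → ShortestPath G g g' → ShortestPath H h h' → ShortestPath (G □ H) (g , h) (g' , h')
  geodesicHG {g} {g'} {h} {h'} pG pH = record
    { len     = len pH + len pG
    ; walk    = liftH g (walk pH) ++ᵂ liftG h' (walk pG)
    ; minimal = λ m w → subst (_≤ m) (ℕ.+-comm (len pG) (len pH)) (productLowerBound pG pH m w) }

  ∈-geodesicGH : ∀ {g g' h h' v} (pG : ShortestPath G g g') (pH : ShortestPath H h h') →
                 v ∈ Verts pG → (v , h) ∈ Verts (geodesicGH pG pH)
  ∈-geodesicGH {g' = g'} {h = h} pG pH p = ∈-++ᵂˡ (liftG h (walk pG)) (liftH g' (walk pH)) (∈-liftG h (walk pG) p)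

  ∈-geodesicHGᴳ : ∀ {g g' h h' v} (pG : ShortestPath G g g') (pH : ShortestPath H h h') →
                  v ∈ Verts pG → (v , h') ∈ Verts (geodesicHG pG pH)
  ∈-geodesicHGᴳ {g = g} {h' = h'} pG pH p = ∈-++ᵂʳ (liftH g (walk pH)) (liftG h' (walk pG)) (∈-liftG h' (walk pG) p)

  ∈-geodesicHGᴴ : ∀ {g g' h h' v} (pG : ShortestPath G g g') (pH : ShortestPath H h h') →
                  v ∈ Verts pH → (g , v) ∈ Verts (geodesicHG pG pH)
  ∈-geodesicHGᴴ {g = g} {h' = h'} pG pH p = ∈-++ᵂˡ (liftH g (walk pH)) (liftG h' (walk pG)) (∈-liftH g (walk pH) p)

-- A path system fixes one shortest
-- path between any two distinct vertices; a vertex is covered by S if it lies on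
-- the chosen path between two distinct members of S (in both orientations, since
-- the definition of strong geodetic sets orients each pair by position in S).

lookup-injective : ∀ {A : Set} {xs : List A} → Unique xs → ∀ {i j} → lookup xs i ≡ lookup xs j → i ≡ j
lookup-injective (_  ∷ _)  {fz}   {fz}   _ = refl
lookup-injective (x∉ ∷ _)  {fz}   {fs j} e = ⊥-elim (All.lookup x∉ (∈-lookup j) e)
lookup-injective (x∉ ∷ _)  {fs i} {fz}   e = ⊥-elim (All.lookup x∉ (∈-lookup i) (sym e))
lookup-injective (_  ∷ u)  {fs i} {fs j} e = cong fs (lookup-injective u e)

module _ {G : Graph} where

  PathSystem : Set
  PathSystem = ∀ a b → a ≢ b → ShortestPath G a b

  totalPath : DecidableEquality (V G) → PathSystem → ∀ a b → ShortestPath G a b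
  totalPath _≟_ P a b with a ≟ b
  ... | yes refl = trivialPath a
  ... | no a≢b   = P a b a≢b

  CoveredBy : List (V G) → PathSystem → V G → Set
  CoveredBy S P v = Σ (V G) λ a → Σ (V G) λ b → a ∈ S × b ∈ S × a ≢ b ×
    (∀ a≢b → v ∈ Verts (P a b a≢b)) × (∀ b≢a → v ∈ Verts (P b a b≢a))

  strongGeodeticFromCover : (S : List (V G)) → Unique S → (P : PathSystem) →
                            (∀ v → CoveredBy S P v) → StrongGeodetic G S
  strongGeodeticFromCover S u P cover = record { distinct = u ; path = chosen ; covers = covered }
    where
    chosen : (i j : Fin (length S)) → i <ᶠ j → ShortestPath G (lookup S i) (lookup S j)
    chosen i j i<j = P (lookup S i) (lookup S j) (Fin.<⇒≢ i<j ∘ lookup-injective u)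

    onPath : ∀ {v a b} → (∀ a≢b → v ∈ Verts (P a b a≢b)) →
             ∀ {x y} → a ≡ x → b ≡ y → (x≢y : x ≢ y) → v ∈ Verts (P x y x≢y)
    onPath v∈P refl refl = v∈P

    covered : ∀ v → Σ (Fin (length S)) λ i → Σ (Fin (length S)) λ j → Σ (i <ᶠ j) λ i<j →
              v ∈ walkVertices (walk (chosen i j i<j))
    covered v with cover v
    ... | a , b , a∈S , b∈S , a≢b , v∈Pab , v∈Pba with <-cmp (index a∈S) (index b∈S)
    ... | tri< lt _ _ = index a∈S , index b∈S , lt , onPath v∈Pab (lookup-index a∈S) (lookup-index b∈S) _
    ... | tri≈ _ e _  = ⊥-elim (a≢b (trans (lookup-index a∈S) (trans (cong (lookup S) e) (sym (lookup-index b∈S)))))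
    ... | tri> _ _ gt = index b∈S , index a∈S , gt , onPath v∈Pba (lookup-index b∈S) (lookup-index a∈S) _

  coveredAsEnd : ∀ S P {v w} → v ∈ S → w ∈ S → v ≢ w → CoveredBy S P v
  coveredAsEnd S P {v} {w} v∈S w∈S v≢w =
    v , w , v∈S , w∈S , v≢w , (λ v≢w → start∈ (walk (P v w v≢w))) , (λ w≢v → end∈ (walk (P w v w≢v)))

module _ {A X : Set} {c : ℕ} (e : Fin c ↔ A) (f : A → X) (f-inj : ∀ {a b} → f a ≡ f b → a ≡ b) where
  open Inverse e using (to; from; strictlyInverseˡ; strictlyInverseʳ)

  to-injective : ∀ {i j} → to i ≡ to j → i ≡ j
  to-injective {i} {j} e = trans (sym (strictlyInverseʳ i)) (trans (cong from e) (strictlyInverseʳ j))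

  imageList : List X
  imageList = tabulate (f ∘ to)

  imageList-length : length imageList ≡ c
  imageList-length = length-tabulate (f ∘ to)

  imageList-unique : Unique imageList
  imageList-unique = tabulate⁺ (to-injective ∘ f-inj)

  ∈-imageList : ∀ a → f a ∈ imageList
  ∈-imageList a = subst (λ b → f b ∈ imageList) (strictlyInverseˡ a) (∈-tabulate⁺ (from a))

  imageList-minimal : ∀ S → (∀ a → f a ∈ S) → c ≤ length S
  imageList-minimal S f∈S = Fin.injective⇒≤ {f = position} position-injective
    where
    position : Fin c → Fin (length S)
    position i = index (f∈S (to i))
    position-injective : ∀ {i j} → position i ≡ position j → i ≡ j
    position-injective {i} {j} e = to-injective (f-inj (index-injective (setoid X) (f∈S (to i)) (f∈S (to j)) e))

-- Pairs i < j in Fin k; there are k C 2 of them, since the pairs in Fin (suc k)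
-- are those starting at 0 (one for each j : Fin k) and the shifted pairs in Fin k.

Pair : ℕ → Set
Pair k = Σ (Fin k) λ i → Σ (Fin k) λ j → i <ᶠ j

pairSplit : ∀ {k} → Pair (suc k) ↔ (Fin k ⊎ Pair k)
pairSplit = mk↔ₛ′ split unsplit split∘unsplit unsplit∘split
  where
  split : ∀ {k} → Pair (suc k) → Fin k ⊎ Pair k
  split (fz   , fs j , _)       = inj₁ j
  split (fs i , fs j , s≤s i<j) = inj₂ (i , j , i<j)
  unsplit : ∀ {k} → Fin k ⊎ Pair k → Pair (suc k)
  unsplit (inj₁ j)           = fz , fs j , s≤s z≤n
  unsplit (inj₂ (i , j , i<j)) = fs i , fs j , s≤s i<j
  split∘unsplit : ∀ {k} (s : Fin k ⊎ Pair k) → split (unsplit s) ≡ s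
  split∘unsplit (inj₁ j)           = refl
  split∘unsplit (inj₂ (i , j , i<j)) = refl
  unsplit∘split : ∀ {k} (p : Pair (suc k)) → unsplit (split p) ≡ p
  unsplit∘split (fz   , fs j , s≤s z≤n) = refl
  unsplit∘split (fs i , fs j , s≤s i<j) = refl

pairCount : ∀ k → Fin (k C 2) ↔ Pair k
pairCount zero    = mk↔ₛ′ (λ ()) (λ { (() , _) }) (λ { (() , _) }) (λ ())
pairCount (suc k) = subst (λ c → Fin c ↔ Pair (suc k)) pascal
  (↔-trans +↔⊎ (↔-trans (↔-refl ⊎-↔ pairCount k) (↔-sym pairSplit)))
  where
  pascal : k + k C 2 ≡ suc k C 2
  pascal = trans (cong (_+ k C 2) (sym (nC1≡n k))) (nCk+nC[k+1]≡[n+1]C[k+1] k 1)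

-- The graph G = G_{k,m+1} (so that each pair has a last subdivision vertex).

module GknFacts (k m : ℕ) where

  G : Graph
  G = Gkn k (suc m)

  Vertex : Set
  Vertex = GV k (suc m)

  subOn : Pair k → Fin (suc m) → Vertex
  subOn (i , j , i<j) x = sub i j i<j x

  subOn-injective : ∀ {p p' x x'} → subOn p x ≡ subOn p' x' → p ≡ p' × x ≡ x'
  subOn-injective {_ , _ , _} {_ , _ , _} refl = refl , refl

  -- The last subdivision index; it is the one left out of the optimal strong geodetic set.
  lastSub : Fin (suc m)
  lastSub = fromℕ m

  _≟_ : (a b : Vertex) → Dec (a ≡ b)
  orig a ≟ orig b with a Fin.≟ b
  ... | yes refl = yes refl
  ... | no a≢b   = no λ { refl → a≢b refl }
  sub i j i<j x ≟ sub i' j' i'<j' x' with i Fin.≟ i' | j Fin.≟ j' | x Fin.≟ x'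
  ... | yes refl | yes refl | yes refl = yes (cong (λ lt → sub i j lt x) (Fin.<-irrelevant i<j i'<j'))
  ... | no i≢i'  | _        | _        = no λ { refl → i≢i' refl }
  ... | yes _    | no j≢j'  | _        = no λ { refl → j≢j' refl }
  ... | yes _    | yes _    | no x≢x'  = no λ { refl → x≢x' refl }
  apex ≟ apex = yes refl
  orig _        ≟ sub _ _ _ _ = no λ ()
  orig _        ≟ apex        = no λ ()
  sub _ _ _ _   ≟ orig _      = no λ ()
  sub _ _ _ _   ≟ apex        = no λ ()
  apex          ≟ orig _      = no λ ()
  apex          ≟ sub _ _ _ _ = no λ ()

  adjacent? : (a b : Vertex) → Dec (GAdj a b)
  adjacent? (orig a)      (sub i j _ _) = (a Fin.≟ i) ⊎-dec (a Fin.≟ j)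
  adjacent? (sub i j _ _) (orig a)      = (a Fin.≟ i) ⊎-dec (a Fin.≟ j)
  adjacent? (orig _)      apex          = yes tt
  adjacent? (sub _ _ _ _) apex          = yes tt
  adjacent? apex          (orig _)      = yes tt
  adjacent? apex          (sub _ _ _ _) = yes tt
  adjacent? (orig _)      (orig _)      = no λ ()
  adjacent? (sub _ _ _ _) (sub _ _ _ _) = no λ ()
  adjacent? apex          apex          = no λ ()

  commonNeighbour : ∀ a b → a ≢ b → ¬ GAdj a b → Σ Vertex λ c → GAdj a c × GAdj c b
  commonNeighbour (orig a) (orig b) a≢b _ with <-cmp a b
  ... | tri< a<b _ _ = sub a b a<b lastSub , inj₁ refl , inj₂ refl
  ... | tri≈ _ a≡b _ = ⊥-elim (a≢b (cong orig a≡b))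
  ... | tri> _ _ b<a = sub b a b<a lastSub , inj₂ refl , inj₁ refl
  commonNeighbour (orig _)      (sub _ _ _ _) _ _ = apex , tt , tt
  commonNeighbour (sub _ _ _ _) (orig _)      _ _ = apex , tt , tt
  commonNeighbour (sub _ _ _ _) (sub _ _ _ _) _ _ = apex , tt , tt
  commonNeighbour (orig _)      apex          _ ¬adj = ⊥-elim (¬adj tt)
  commonNeighbour (sub _ _ _ _) apex          _ ¬adj = ⊥-elim (¬adj tt)
  commonNeighbour apex          (orig _)      _ ¬adj = ⊥-elim (¬adj tt)
  commonNeighbour apex          (sub _ _ _ _) _ ¬adj = ⊥-elim (¬adj tt)
  commonNeighbour apex          apex          a≢b _ = ⊥-elim (a≢b refl)

  geodesicVia : ∀ a b → a ≢ b → Dec (GAdj a b) → ShortestPath G a b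
  geodesicVia a b a≢b (yes adj) = edgePath a≢b adj
  geodesicVia a b a≢b (no ¬adj) with commonNeighbour a b a≢b ¬adj
  ... | c , ac , cb = twoEdgePath c a≢b ¬adj ac cb

  geodesic : PathSystem {G}
  geodesic a b a≢b = geodesicVia a b a≢b (adjacent? a b)

  diameter≤2 : ∀ a b a≢b → len (geodesic a b a≢b) ≤ 2
  diameter≤2 a b a≢b with adjacent? a b
  ... | yes _ = s≤s z≤n
  ... | no _  = s≤s (s≤s z≤n)

  Joins : Fin k → Fin k → Vertex → Vertex → Set
  Joins i j u w = (u ≡ orig i × w ≡ orig j) ⊎ (u ≡ orig j × w ≡ orig i)

  neighboursOfSub : ∀ {i j i<j x} u w → GAdj u (sub i j i<j x) → GAdj (sub i j i<j x) w →
                    u ≢ w → ¬ GAdj u w → Joins i j u w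
  neighboursOfSub (orig _) (orig _) (inj₁ refl) (inj₂ refl) _ _ = inj₁ (refl , refl)
  neighboursOfSub (orig _) (orig _) (inj₂ refl) (inj₁ refl) _ _ = inj₂ (refl , refl)
  neighboursOfSub (orig _) (orig _) (inj₁ refl) (inj₁ refl) u≢w _ = ⊥-elim (u≢w refl)
  neighboursOfSub (orig _) (orig _) (inj₂ refl) (inj₂ refl) u≢w _ = ⊥-elim (u≢w refl)
  neighboursOfSub (orig _) apex     _ _ _ ¬adj = ⊥-elim (¬adj tt)
  neighboursOfSub apex     (orig _) _ _ _ ¬adj = ⊥-elim (¬adj tt)
  neighboursOfSub apex     apex     _ _ u≢w _  = ⊥-elim (u≢w refl)

  threeVertices : ∀ {A : Set} {y a b c : A} → y ∈ (a ∷ b ∷ c ∷ []) → y ≡ a ⊎ y ≡ b ⊎ y ≡ c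
  threeVertices (here e)                 = inj₁ e
  threeVertices (there (here e))         = inj₂ (inj₁ e)
  threeVertices (there (there (here e))) = inj₂ (inj₂ e)

  throughSub : ∀ {a b} (a<b : a <ᶠ b) x → ShortestPath G (orig a) (orig b)
  throughSub a<b x = twoEdgePath (sub _ _ a<b x) (λ { refl → ℕ.<-irrefl refl a<b }) (λ ()) (inj₁ refl) (inj₂ refl)

  throughSubᵒ : ∀ {a b} (a<b : a <ᶠ b) x → ShortestPath G (orig b) (orig a)
  throughSubᵒ a<b x = twoEdgePath (sub _ _ a<b x) (λ { refl → ℕ.<-irrefl refl a<b }) (λ ()) (inj₂ refl) (inj₁ refl)

  geodesic≤2 : ∀ {u w} (P : ShortestPath G u w) → len P ≤ 2
  geodesic≤2 {u} {w} P with u ≟ w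
  ... | yes refl = ℕ.≤-trans (minimal P 0 here) z≤n
  ... | no u≢w   = ℕ.≤-trans (minimal P _ (walk (geodesic u w u≢w))) (diameter≤2 u w u≢w)

  innerSub : ∀ {i j i<j x u w l} (W : Walk G u w l) → l ≤ 2 → (∀ l' → Walk G u w l' → l ≤ l') →
             sub i j i<j x ∈ walkVertices W → sub i j i<j x ≢ u → sub i j i<j x ≢ w →
             Joins i j u w × (∀ y → y ∈ walkVertices W → y ≡ u ⊎ y ≡ sub i j i<j x ⊎ y ≡ w)
  innerSub here                     _ _ (here s≡u)                 s≢u _   = ⊥-elim (s≢u s≡u)
  innerSub (step _ here)            _ _ (here s≡u)                 s≢u _   = ⊥-elim (s≢u s≡u)
  innerSub (step _ here)            _ _ (there (here s≡w))         _   s≢w = ⊥-elim (s≢w s≡w)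
  innerSub (step _ (step _ here))   _ _ (here s≡u)                 s≢u _   = ⊥-elim (s≢u s≡u)
  innerSub (step _ (step _ here))   _ _ (there (there (here s≡w))) _   s≢w = ⊥-elim (s≢w s≡w)
  innerSub {u = u} {w} (step us (step sw here)) _ minimal₂ (there (here refl)) _ _ =
    neighboursOfSub u w us sw u≢w ¬adj , λ _ → threeVertices
    where
    u≢w : u ≢ w
    u≢w refl with minimal₂ 0 here
    ... | ()
    ¬adj : ¬ GAdj u w
    ¬adj uw with minimal₂ 1 (step uw here)
    ... | s≤s ()
  innerSub (step _ (step _ (step _ _))) (s≤s (s≤s ())) _ _ _ _

  innerSubOfGeodesic : ∀ {i j i<j x u w} (P : ShortestPath G u w) →
    sub i j i<j x ∈ Verts P → sub i j i<j x ≢ u → sub i j i<j x ≢ w →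
    Joins i j u w × (∀ y → y ∈ Verts P → y ≡ u ⊎ y ≡ sub i j i<j x ⊎ y ≡ w)
  innerSubOfGeodesic P = innerSub (walk P) (geodesic≤2 P) (minimal P)

  Slots : Set
  Slots = (Pair k × Fin m) ⊎ Fin k

  slotCount : Fin ((k C 2) * m + k) ↔ Slots
  slotCount = ↔-trans +↔⊎ (↔-trans *↔× (pairCount k ×-↔ ↔-refl) ⊎-↔ ↔-refl)

-- Lower bound sg(G_{k,m+1}) ≥ (k C 2)·m + k for k ≥ 3.  For a strong geodetic
-- set S: (A) each pair {i, j} has at most one subdivision vertex outside S, since
-- such a vertex is covered only by the geodesic x_i - s - x_j; (B) if x_a ∉ S then
-- all subdivision vertices of pairs containing a are in S.  Hence on each pair
-- every slot but one (the missing one, or the last) is in S, and each original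
-- vertex is represented in S either by itself or, if absent, by the remaining
-- slot of the pair {a, a+1 mod k}.  These representatives are all distinct.

module LowerBound (k₀ m : ℕ) where
  k : ℕ
  k = 3 + k₀
  open GknFacts k m

  -- i ↦ {i, i+1}, and the last vertex ↦ {0, k-1}: an injective choice of a pair containing i.
  cyclicPairOf : (i : Fin k) → View i → Pair k
  cyclicPairOf _ ‵fromℕ                = fz , fromℕ (2 + k₀) , s≤s z≤n
  cyclicPairOf _ (‵inj₁ {i = i} _) = inject₁ i , fs i , Fin.≤̄⇒inject₁< ℕ.≤-refl

  cyclicPair : Fin k → Pair k
  cyclicPair i = cyclicPairOf i (view i)

  cyclicPair-injective : ∀ {i i'} → cyclicPair i ≡ cyclicPair i' → i ≡ i'
  cyclicPair-injective {i} {i'} = injective (view i) (view i')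
    where
    injective : ∀ {i i'} (v : View i) (v' : View i') → cyclicPairOf i v ≡ cyclicPairOf i' v' → i ≡ i'
    injective ‵fromℕ                ‵fromℕ                 _ = refl
    injective ‵fromℕ                (‵inj₁ {i = fz} _)     ()
    injective ‵fromℕ                (‵inj₁ {i = fs _} _)   ()
    injective (‵inj₁ {i = fz} _)    ‵fromℕ                 ()
    injective (‵inj₁ {i = fs _} _)  ‵fromℕ                 ()
    injective (‵inj₁ _)             (‵inj₁ _)              e = cong proj₁ e

  cyclicPair-contains : ∀ i → i ≡ proj₁ (cyclicPair i) ⊎ i ≡ proj₁ (proj₂ (cyclicPair i))
  cyclicPair-contains i = contains (view i)
    where
    contains : ∀ {i} (v : View i) → i ≡ proj₁ (cyclicPairOf i v) ⊎ i ≡ proj₁ (proj₂ (cyclicPairOf i v))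
    contains ‵fromℕ    = inj₂ refl
    contains (‵inj₁ _) = inj₁ refl

  module _ (S : List Vertex) (sg : StrongGeodetic G S) where
    open StrongGeodetic sg
    open import Data.List.Membership.DecPropositional _≟_ using (_∈?_)

    ∉⇒≢lookup : ∀ {v} → v ∉ S → ∀ i → v ≢ lookup S i
    ∉⇒≢lookup v∉S i v≡ = v∉S (subst (_∈ S) (sym v≡) (∈-lookup i))

    missingOnPath : ∀ {i j i<j x} → sub i j i<j x ∉ S →
      Σ (Fin (length S)) λ a → Σ (Fin (length S)) λ b → Σ (a <ᶠ b) λ a<b →
        sub i j i<j x ∈ Verts (path a b a<b) × Joins i j (lookup S a) (lookup S b) ×
        (∀ y → y ∈ Verts (path a b a<b) → y ≡ lookup S a ⊎ y ≡ sub i j i<j x ⊎ y ≡ lookup S b)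
    missingOnPath {i} {j} {i<j} {x} s∉S with covers (sub i j i<j x)
    ... | a , b , a<b , s∈P = a , b , a<b , s∈P ,
          innerSubOfGeodesic (path a b a<b) s∈P (∉⇒≢lookup s∉S a) (∉⇒≢lookup s∉S b)

    sameEntry : ∀ {a a' v} → lookup S a ≡ v → lookup S a' ≡ v → a ≡ a'
    sameEntry e e' = lookup-injective distinct (trans e (sym e'))

    crossed : ∀ {a b a' b' : Fin (length S)} → a <ᶠ b → a' <ᶠ b' → b ≡ a' → b' ≡ a → ⊥
    crossed a<b a'<b' refl refl = ℕ.<-asym a<b a'<b'

    samePositions : ∀ {i j a b a' b'} → a <ᶠ b → a' <ᶠ b' →
      Joins i j (lookup S a) (lookup S b) → Joins i j (lookup S a') (lookup S b') → a ≡ a' × b ≡ b'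
    samePositions _ _ (inj₁ (a≡ , b≡)) (inj₁ (a'≡ , b'≡)) = sameEntry a≡ a'≡ , sameEntry b≡ b'≡
    samePositions _ _ (inj₂ (a≡ , b≡)) (inj₂ (a'≡ , b'≡)) = sameEntry a≡ a'≡ , sameEntry b≡ b'≡
    samePositions a<b a'<b' (inj₁ (a≡ , b≡)) (inj₂ (a'≡ , b'≡)) =
      ⊥-elim (crossed a<b a'<b' (sameEntry b≡ a'≡) (sameEntry b'≡ a≡))
    samePositions a<b a'<b' (inj₂ (a≡ , b≡)) (inj₁ (a'≡ , b'≡)) =
      ⊥-elim (crossed a<b a'<b' (sameEntry b≡ a'≡) (sameEntry b'≡ a≡))

    atMostOneMissing : ∀ {i j i<j x y} → sub i j i<j x ∉ S → sub i j i<j y ∉ S → x ≡ y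
    atMostOneMissing {i} {j} {i<j} {x} {y} sx∉S sy∉S
      with missingOnPath sx∉S | missingOnPath sy∉S
    ... | a , b , a<b , _ , joins , onlyThree | _ , _ , a'<b' , sy∈P' , joins' , _
      with samePositions a<b a'<b' joins joins'
    ... | refl , refl
      with onlyThree _ (subst (λ lt → sub i j i<j y ∈ Verts (path a b lt)) (Fin.<-irrelevant a'<b' a<b) sy∈P')
    ... | inj₁ sy≡       = ⊥-elim (∉⇒≢lookup sy∉S a sy≡)
    ... | inj₂ (inj₁ refl) = refl
    ... | inj₂ (inj₂ sy≡) = ⊥-elim (∉⇒≢lookup sy∉S b sy≡)

    joinedInS : ∀ {i j a b} → Joins i j (lookup S a) (lookup S b) → orig i ∈ S × orig j ∈ S
    joinedInS {a = a} {b} (inj₁ (a≡ , b≡)) = subst (_∈ S) a≡ (∈-lookup a) , subst (_∈ S) b≡ (∈-lookup b)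
    joinedInS {a = a} {b} (inj₂ (a≡ , b≡)) = subst (_∈ S) b≡ (∈-lookup b) , subst (_∈ S) a≡ (∈-lookup a)

    subNextToMissingIn : ∀ {a i j i<j} x → orig a ∉ S → a ≡ i ⊎ a ≡ j → sub i j i<j x ∈ S
    subNextToMissingIn {i = i} {j} {i<j} x oa∉S a∈ij with sub i j i<j x ∈? S
    ... | yes s∈S = s∈S
    ... | no s∉S with missingOnPath s∉S
    ... | _ , _ , _ , _ , joins , _ with joinedInS joins | a∈ij
    ... | oi∈S , _ | inj₁ refl = ⊥-elim (oa∉S oi∈S)
    ... | _ , oj∈S | inj₂ refl = ⊥-elim (oa∉S oj∈S)

    MissingOn : Pair k → Set
    MissingOn p = ∃ λ x → subOn p x ∉ S

    freeSlotOf : ∀ {p} → Dec (MissingOn p) → Fin (suc m)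
    freeSlotOf (yes (x , _)) = x
    freeSlotOf (no _)        = lastSub

    freeSlot : Pair k → Fin (suc m)
    freeSlot p = freeSlotOf (Fin.any? λ x → ¬? (subOn p x ∈? S))

    otherSlotIn : ∀ p l → subOn p (punchIn (freeSlot p) l) ∈ S
    otherSlotIn p l = occupied p (Fin.any? λ x → ¬? (subOn p x ∈? S))
      where
      occupied : ∀ p (d : Dec (MissingOn p)) → subOn p (punchIn (freeSlotOf d) l) ∈ S
      occupied (i , j , i<j) (yes (x , sx∉S)) = decidable-stable (_ ∈? S)
        λ s∉S → Fin.punchInᵢ≢i x l (sym (atMostOneMissing sx∉S s∉S))
      occupied p (no none) = decidable-stable (_ ∈? S) λ s∉S → none (_ , s∉S)

    representativeOf : ∀ i → Dec (orig i ∈ S) → Vertex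
    representativeOf i (yes _) = orig i
    representativeOf i (no _)  = subOn (cyclicPair i) (freeSlot (cyclicPair i))

    -- By (B), the free slot of a pair containing a missing x_i is in S.
    representativeIn : ∀ i (d : Dec (orig i ∈ S)) → representativeOf i d ∈ S
    representativeIn i (yes oi∈S) = oi∈S
    representativeIn i (no oi∉S) with cyclicPair i | cyclicPair-contains i
    ... | _ , _ , _ | i∈pair = subNextToMissingIn _ oi∉S i∈pair

    representativeOf-injective : ∀ i i' d d' → representativeOf i d ≡ representativeOf i' d' → i ≡ i'
    representativeOf-injective i i' (yes _) (yes _) refl = refl
    representativeOf-injective i i' (no _)  (no _)  e    = cyclicPair-injective (proj₁ (subOn-injective e))
    representativeOf-injective i i' (yes _) (no _)  e    with cyclicPair i'
    representativeOf-injective i i' (yes _) (no _)  ()   | _ , _ , _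
    representativeOf-injective i i' (no _)  (yes _) e    with cyclicPair i
    representativeOf-injective i i' (no _)  (yes _) ()   | _ , _ , _

    witness : Slots → Vertex
    witness (inj₁ (p , l)) = subOn p (punchIn (freeSlot p) l)
    witness (inj₂ i)       = representativeOf i (orig i ∈? S)

    witness-∈ : ∀ s → witness s ∈ S
    witness-∈ (inj₁ (p , l)) = otherSlotIn p l
    witness-∈ (inj₂ i)       = representativeIn i (orig i ∈? S)

    -- A slot image avoids the free slot, so it differs from every representative.
    slotNotFree : ∀ p l i d → subOn p (punchIn (freeSlot p) l) ≢ representativeOf i d
    slotNotFree (_ , _ , _) l i (yes _) ()
    slotNotFree p l i (no _) e with subOn-injective e
    ... | refl , punchIn≡free = Fin.punchInᵢ≢i (freeSlot p) l punchIn≡free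

    witness-injective : ∀ {s t} → witness s ≡ witness t → s ≡ t
    witness-injective {inj₁ (p , l)} {inj₁ (p' , l')} e with subOn-injective {p} {p'} e
    ... | refl , punchIn≡ = cong (λ l → inj₁ (p , l)) (Fin.punchIn-injective (freeSlot p) l l' punchIn≡)
    witness-injective {inj₁ (p , l)} {inj₂ i}        e = ⊥-elim (slotNotFree p l i _ e)
    witness-injective {inj₂ i}       {inj₁ (p , l)}  e = ⊥-elim (slotNotFree p l i _ (sym e))
    witness-injective {inj₂ i}       {inj₂ i'}       e = cong inj₂ (representativeOf-injective i i' _ _ e)

  lowerBound : ∀ S → StrongGeodetic G S → (k C 2) * m + k ≤ length S
  lowerBound S sg = imageList-minimal slotCount (witness S sg) (witness-injective S sg) S (witness-∈ S sg)

-- Upper bound sg(G_{k,m+1}) ≤ (k C 2)·m + k for k ≥ 3 and m ≥ 1: take all original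
-- vertices and all but the last subdivision vertex of every pair.  The last one
-- of {i, j} lies on the geodesic x_i - s - x_j, and the apex lies on the geodesic
-- between subdivision vertices of two different pairs.

module UpperBound (k₀ m₀ : ℕ) where
  k m : ℕ
  k = 3 + k₀
  m = suc m₀
  open GknFacts k m

  member : Slots → Vertex
  member (inj₁ (p , l)) = subOn p (inject₁ l)
  member (inj₂ i)       = orig i

  member-injective : ∀ {s t} → member s ≡ member t → s ≡ t
  member-injective {inj₁ (p , l)} {inj₁ (p' , l')} e with subOn-injective {p} {p'} e
  ... | refl , inject≡ = cong (λ l → inj₁ (p , l)) (Fin.inject₁-injective inject≡)
  member-injective {inj₁ ((_ , _ , _) , _)} {inj₂ _} ()
  member-injective {inj₂ _} {inj₁ ((_ , _ , _) , _)} ()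
  member-injective {inj₂ _} {inj₂ _} refl = refl

  S : List Vertex
  S = imageList slotCount member member-injective

  member-∈ : ∀ s → member s ∈ S
  member-∈ = ∈-imageList slotCount member member-injective

  lastSub∈geodesic : ∀ i j (i<j : i <ᶠ j) i≢j → sub i j i<j lastSub ∈ Verts (geodesic (orig i) (orig j) i≢j)
  lastSub∈geodesic i j i<j _ with <-cmp i j
  ... | tri< i<j' _ _ rewrite Fin.<-irrelevant i<j i<j' = there (here refl)
  ... | tri≈ ¬i<j _ _ = ⊥-elim (¬i<j i<j)
  ... | tri> ¬i<j _ _ = ⊥-elim (¬i<j i<j)

  lastSub∈geodesicᵒ : ∀ i j (i<j : i <ᶠ j) j≢i → sub i j i<j lastSub ∈ Verts (geodesic (orig j) (orig i) j≢i)
  lastSub∈geodesicᵒ i j i<j _ with <-cmp j i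
  ... | tri< j<i _ _ = ⊥-elim (ℕ.<-asym i<j j<i)
  ... | tri≈ _ j≡i _ = ⊥-elim (ℕ.<-irrefl (cong toℕ (sym j≡i)) i<j)
  ... | tri> _ _ i<j' rewrite Fin.<-irrelevant i<j i<j' = there (here refl)

  subCovered : ∀ i j i<j x → View x → CoveredBy S geodesic (sub i j i<j x)
  subCovered i j i<j _ ‵fromℕ =
    orig i , orig j , member-∈ (inj₂ i) , member-∈ (inj₂ j) , (λ { refl → ℕ.<-irrefl refl i<j }) ,
    lastSub∈geodesic i j i<j , lastSub∈geodesicᵒ i j i<j
  subCovered i j i<j _ (‵inj₁ {i = l} _) =
    coveredAsEnd S geodesic (member-∈ (inj₁ ((i , j , i<j) , l))) (member-∈ (inj₂ fz)) (λ ())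

  -- Two distinct pairs; their subdivision vertices are joined through the apex.
  p₀₁ p₀₂ : Pair k
  p₀₁ = fz , fs fz , s≤s z≤n
  p₀₂ = fz , fs (fs fz) , s≤s z≤n

  covered : ∀ v → CoveredBy S geodesic v
  covered (orig i)        = coveredAsEnd S geodesic (member-∈ (inj₂ i)) (member-∈ (inj₁ (p₀₁ , fz))) (λ ())
  covered (sub i j i<j x) = subCovered i j i<j x (view x)
  covered apex            = subOn p₀₁ fz , subOn p₀₂ fz , member-∈ (inj₁ (p₀₁ , fz)) , member-∈ (inj₁ (p₀₂ , fz)) ,
    (λ ()) , (λ _ → there (here refl)) , (λ _ → there (here refl))

  upperBound : Σ (List Vertex) λ S → StrongGeodetic G S × length S ≡ (k C 2) * m + k
  upperBound = S , strongGeodeticFromCover S (imageList-unique slotCount member member-injective) geodesic covered ,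
               imageList-length slotCount member member-injective

-- sg(G_{k,n} □ K_n) ≤ kn + 1: take the n copies of every original vertex and one
-- copy of the apex.  A geodesic between (x_a, h) and (x_b, h') with a < b first
-- crosses G at level h through the subdivision vertex with index h', then moves
-- in K_n; in the other orientation it moves in K_n first.  So (s, t) for s the
-- x-th subdivision vertex of {i, j} is covered by (x_i, t) and (x_j, x).  The
-- apex copies (apex, t) are covered by (apex, 0) and (x_0, t).

module ProductBound (k₀ m : ℕ) where
  k n : ℕ
  k = suc k₀
  n = suc m
  open GknFacts k m

  G□K : Graph
  G□K = G □ K n

  completeGeodesic : ∀ h h' → ShortestPath (K n) h h'
  completeGeodesic = totalPath Fin._≟_ (λ _ _ h≢h' → edgePath h≢h' h≢h')

  geodesicᴳ : ∀ g g' → ShortestPath G g g'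
  geodesicᴳ = totalPath _≟_ geodesic

  -- Geodesics between copies of original vertices, routed through the
  -- subdivision vertex indexed by the K_n-coordinate of the larger end.
  origGeodesic : ∀ a b h h' → Tri (a <ᶠ b) (a ≡ b) (b <ᶠ a) → ShortestPath G□K (orig a , h) (orig b , h')
  origGeodesic a b h h' (tri< a<b _ _) = geodesicGH (throughSub a<b h') (completeGeodesic h h')
  origGeodesic a _ h h' (tri≈ _ refl _) = geodesicGH (trivialPath (orig a)) (completeGeodesic h h')
  origGeodesic a b h h' (tri> _ _ b<a) = geodesicHG (throughSubᵒ b<a h) (completeGeodesic h h')

  -- From the apex move in K_n first (so (apex, t) is reached); otherwise in G first.
  productGeodesic : PathSystem {G□K}
  productGeodesic (orig a , h) (orig b , h') _ = origGeodesic a b h h' (<-cmp a b)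
  productGeodesic (apex   , h) (g'     , h') _ = geodesicHG (geodesicᴳ apex g') (completeGeodesic h h')
  productGeodesic (g      , h) (g'     , h') _ = geodesicGH (geodesicᴳ g g') (completeGeodesic h h')

  sub∈origGeodesic : ∀ i j (i<j : i <ᶠ j) x t ne → (sub i j i<j x , t) ∈ Verts (productGeodesic (orig i , t) (orig j , x) ne)
  sub∈origGeodesic i j i<j x t _ with <-cmp i j
  ... | tri< i<j' _ _ rewrite Fin.<-irrelevant i<j i<j' = ∈-geodesicGH (throughSub i<j' x) (completeGeodesic t x) (there (here refl))
  ... | tri≈ ¬i<j _ _ = ⊥-elim (¬i<j i<j)
  ... | tri> ¬i<j _ _ = ⊥-elim (¬i<j i<j)

  sub∈origGeodesicᵒ : ∀ i j (i<j : i <ᶠ j) x t ne → (sub i j i<j x , t) ∈ Verts (productGeodesic (orig j , x) (orig i , t) ne)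
  sub∈origGeodesicᵒ i j i<j x t _ with <-cmp j i
  ... | tri< j<i _ _ = ⊥-elim (ℕ.<-asym i<j j<i)
  ... | tri≈ _ j≡i _ = ⊥-elim (ℕ.<-irrefl (cong toℕ (sym j≡i)) i<j)
  ... | tri> _ _ i<j' rewrite Fin.<-irrelevant i<j i<j' = ∈-geodesicHGᴳ (throughSubᵒ i<j' x) (completeGeodesic x t) (there (here refl))

  Members : Set
  Members = (Fin k × Fin n) ⊎ Fin 1

  memberCount : Fin (k * n + 1) ↔ Members
  memberCount = ↔-trans +↔⊎ (*↔× ⊎-↔ ↔-refl)

  member : Members → V G□K
  member (inj₁ (i , t)) = orig i , t
  member (inj₂ _)       = apex , fz

  member-injective : ∀ {s t} → member s ≡ member t → s ≡ t
  member-injective {inj₁ _}  {inj₁ _}  refl = refl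
  member-injective {inj₂ fz} {inj₂ fz} refl = refl
  member-injective {inj₁ _}  {inj₂ _}  ()
  member-injective {inj₂ _}  {inj₁ _}  ()

  S : List (V G□K)
  S = imageList memberCount member member-injective

  member-∈ : ∀ s → member s ∈ S
  member-∈ = ∈-imageList memberCount member member-injective

  covered : ∀ v → CoveredBy S productGeodesic v
  covered (orig i , t) = coveredAsEnd S productGeodesic (member-∈ (inj₁ (i , t))) (member-∈ (inj₂ fz)) (λ ())
  covered (sub i j i<j x , t) = (orig i , t) , (orig j , x) , member-∈ (inj₁ (i , t)) , member-∈ (inj₁ (j , x)) ,
    (λ { refl → ℕ.<-irrefl refl i<j }) , sub∈origGeodesic i j i<j x t , sub∈origGeodesicᵒ i j i<j x t
  covered (apex , t) = (apex , fz) , (orig fz , t) , member-∈ (inj₂ fz) , member-∈ (inj₁ (fz , t)) , (λ ()) ,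
    (λ _ → ∈-geodesicHGᴴ (geodesicᴳ apex (orig fz)) (completeGeodesic fz t) (end∈ (walk (completeGeodesic fz t)))) ,
    (λ _ → ∈-geodesicGH (geodesicᴳ (orig fz) apex) (completeGeodesic t fz) (end∈ (walk (geodesicᴳ (orig fz) apex))))

  productBound : Σ (List (V G□K)) λ S → StrongGeodetic G□K S × length S ≤ k * n + 1
  productBound = S , strongGeodeticFromCover S (imageList-unique memberCount member member-injective) productGeodesic covered ,
                 ℕ.≤-reflexive (imageList-length memberCount member member-injective)

-- Theorem 7.1: for k ≥ 4 and n ≥ 2, sg(G_{k,n}) = (k C 2)(n - 1) + k and
-- sg(G_{k,n} □ K_n) ≤ kn + 1.  (The argument only needs k ≥ 3 and, for the
-- product, k, n ≥ 1.)
theorem7p1 : (k n : ℕ) → 4 ≤ k → 2 ≤ n →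
    SgEq (Gkn k n) ((k C 2) * (n ∸ 1) + k)
    × (Σ (List (V (Gkn k n □ K n))) λ S → StrongGeodetic (Gkn k n □ K n) S × length S ≤ k * n + 1)
theorem7p1 (suc (suc (suc k₀))) (suc (suc m₀)) (s≤s (s≤s (s≤s (s≤s _)))) (s≤s (s≤s _)) =
  (UpperBound.upperBound k₀ m₀ , LowerBound.lowerBound k₀ (suc m₀)) ,
  ProductBound.productBound (suc (suc k₀)) (suc m₀)
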